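{- Let $c>1$ be odd and let $n>c$ be even. Then the number of even non-avoiders in $S_n$ equals the number of odd non-avoiders in $S_n$.
   Context: Permutations are written in one-line notation. A hit in a permutation $\sigma\in S_n$ is a contiguous factor $\sigma_i\sigma_{i+1}\cdots\sigma_{i+c-1}$ of length $c$ whose order permutation (the permutation of $\{1,\ldots,c\}$ with the same relative order) is a cyclic shift $a(a+1)\cdots c\,1\,2\cdots(a-1)$ of the identity $12\cdots c$ for some $a\in\{1,\ldots,c\}$. A non-avoider is a permutation containing at least one hit. Even/odd refers to the sign of the permutation. -}

module Defs where

open import Data.Bool using (Bool; true; false; _∧_; not; if_then_else_)
open import Data.Nat using (ℕ; zero; suc; _+_; _<ᵇ_; _≡ᵇ_; _≤ᵇ_; _%_)
open import Data.Fin using (Fin; toℕ)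
open import Data.List using (List; []; _∷_; _++_; map; filter; length; take; zip; upTo; allFin; concatMap)
open import Data.Bool.ListAction using (any; all)
open import Data.Vec using (Vec)
import Data.Vec as Vec
open import Data.Product using (_,_)
open import Relation.Nullary.Decidable using (T?)
open import Data.Bool using (T)

-- Permutations of {1,…,n} in one-line notation are represented as
-- words σ : Vec (Fin n) n with pairwise distinct entries (values are
-- 0-based, i.e. value k stands for k+1; order patterns and signs are
-- unaffected by this shift).

words : {A : Set} → (m : ℕ) → List A → List (Vec A m)
words zero    xs = Vec.[] ∷ []
words (suc m) xs = concatMap (λ x → map (x Vec.∷_) (words m xs)) xs

distinctᵇ : List ℕ → Bool
distinctᵇ []       = true
distinctᵇ (x ∷ xs) = not (any (x ≡ᵇ_) xs) ∧ distinctᵇ xs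

oneLine : {n : ℕ} → Vec (Fin n) n → List ℕ
oneLine σ = Vec.toList (Vec.map toℕ σ)

perms : (n : ℕ) → List (Vec (Fin n) n)
perms n = filter (λ σ → T? (distinctᵇ (oneLine σ))) (words n (allFin n))

inversions : List ℕ → ℕ
inversions []       = 0
inversions (x ∷ xs) = length (filter (λ y → T? (y <ᵇ x)) xs) + inversions xs

isEvenᵇ : ℕ → Bool
isEvenᵇ k = (k % 2) ≡ᵇ 0

evenPermᵇ : List ℕ → Bool
evenPermᵇ w = isEvenᵇ (inversions w)

sameOrderᵇ : List ℕ → List ℕ → Bool
sameOrderᵇ []       []       = true
sameOrderᵇ (x ∷ xs) (y ∷ ys) =
  all (λ { (x' , y') → (x <ᵇ x') ≡ᵇᵇ (y <ᵇ y') }) (zip xs ys) ∧ sameOrderᵇ xs ys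
  where
    _≡ᵇᵇ_ : Bool → Bool → Bool
    true  ≡ᵇᵇ b = b
    false ≡ᵇᵇ b = not b
sameOrderᵇ _        _        = false

-- the cyclic shift  a (a+1) ⋯ c 1 2 ⋯ (a-1)  of 12⋯c, written 0-based:
-- for s = a - 1 ∈ {0,…,c-1}, position i ∈ {0,…,c-1} carries (i + s) mod c
cyclicShift : (c : ℕ) → ℕ → List ℕ
cyclicShift zero    s = []
cyclicShift (suc k) s = map (λ i → (i + s) % suc k) (upTo (suc k))

factors : ℕ → List ℕ → List (List ℕ)
factors c []       = []
factors c (x ∷ xs) =
  (if c ≤ᵇ length (x ∷ xs) then take c (x ∷ xs) ∷ [] else []) ++ factors c xs

isHitᵇ : ℕ → List ℕ → Bool
isHitᵇ c f = any (λ s → sameOrderᵇ f (cyclicShift c s)) (upTo c)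

nonAvoiderᵇ : ℕ → List ℕ → Bool
nonAvoiderᵇ c w = any (isHitᵇ c) (factors c w)

evenNonAvoiders : ℕ → ℕ → ℕ
evenNonAvoiders c n =
  length (filter (λ σ → T? (nonAvoiderᵇ c (oneLine σ) ∧ evenPermᵇ (oneLine σ))) (perms n))

oddNonAvoiders : ℕ → ℕ → ℕ
oddNonAvoiders c n =
  length (filter (λ σ → T? (nonAvoiderᵇ c (oneLine σ) ∧ not (evenPermᵇ (oneLine σ)))) (perms n))

module Submission where

-- Write n = m + 1 and let ρ(x) = x + 1 mod n act on the (0-based) letters {0,…,m}. The map
-- σ ↦ ρ ∘ σ is a bijection of S_n, and since ρ is an n-cycle with n even it changes the sign of
-- every permutation. It also preserves non-avoiders. On a factor not containing m, ρ is
-- increasing, so the order pattern is unchanged. On a factor containing m, m sits where the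
-- pattern has its maximum, and ρ acts on the pattern as the rotation x ↦ x + 1 mod c, which sends
-- a cyclic shift of 12⋯c to the next one. As ρⁿ is the identity, ρ also reflects non-avoiders,
-- so σ ↦ ρ ∘ σ maps the even non-avoiders bijectively onto the odd ones.

open import Defs
open import Data.Bool using (Bool; true; false; _∧_; not; T)
open import Data.Bool.Properties using (T-∧; not-involutive)
open import Data.Bool.ListAction using (any)
open import Data.Empty using (⊥-elim)
open import Data.Fin using (Fin; toℕ; fromℕ; fromℕ<; inject₁) renaming (zero to fzero; suc to fsuc)
open import Data.Fin.Properties using (toℕ-fromℕ<; toℕ-fromℕ; toℕ-inject₁; toℕ-injective; toℕ<n)
open import Data.List
  using (List; []; _∷_; _++_; _∷ʳ_; map; filter; length; concatMap; zip; upTo; take; drop; tabulate; allFin)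
open import Data.List.Properties
  using (length-++; length-map; length-upTo; map-cong; map-cong-local; map-id; map-id-local; map-∘; take-map;
         map-tabulate; tabulate-cong; filter-++; filter-accept; filter-reject; filter-all)
open import Data.List.Membership.Propositional using (_∈_; find; lose)
open import Data.List.Membership.Propositional.Properties using (∈-++⁺ʳ; ∈-∃++; ∈-upTo⁺; ∈-upTo⁻; ∈-map⁺)
open import Data.List.Relation.Binary.Permutation.Propositional using (_↭_; ↭-sym)
import Data.List.Relation.Binary.Permutation.Propositional.Properties as ↭
open import Data.List.Relation.Binary.Pointwise using (Pointwise; []; _∷_)
import Data.List.Relation.Binary.Pointwise as Pointwise
open import Data.List.Relation.Unary.All using (All; []; _∷_)
import Data.List.Relation.Unary.All as All
import Data.List.Relation.Unary.All.Properties as All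
open import Data.List.Relation.Unary.All.Properties using (all⁺; all⁻)
open import Data.List.Relation.Unary.Any using (here; there)
import Data.List.Relation.Unary.Any as Any
open import Data.List.Relation.Unary.Any.Properties using (any⁺; any⁻)
open import Data.List.Relation.Unary.AllPairs using ([]; _∷_)
open import Data.List.Relation.Unary.Unique.Propositional using (Unique)
import Data.List.Relation.Unary.Unique.Propositional.Properties as Unique
open import Data.Nat using (ℕ; zero; suc; _+_; _*_; _<_; _≤_; _<ᵇ_; _≡ᵇ_; _≤ᵇ_; _%_; z≤n; s≤s; s≤s⁻¹; _≟_; NonZero)
open import Data.Nat.Properties
open import Data.Nat.Divisibility using (_∣_; divides)
open import Data.Nat.DivMod using (%-distribˡ-+; m%n<n; m%n%n≡m%n; n%n≡0; m≤n⇒m%n≡m; [m+n]%n≡m%n)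
open import Data.Nat.GeneralisedArithmetic using (iterate)
open import Data.Nat.ListAction using (sum)
open import Data.Nat.ListAction.Properties using (sum-↭)
open import Data.Nat.Solver using (module +-*-Solver)
open import Data.List.Membership.DecPropositional _≟_ using (_∈?_)
open import Data.Product using (_×_; _,_; proj₁; proj₂; ∃-syntax)
open import Data.Sum using (_⊎_; inj₁; inj₂)
open import Data.Vec using (Vec)
import Data.Vec as Vec
import Data.Vec.Properties as Vec
open import Function using (id; _∘_)
open import Function.Bundles using (Equivalence)
open import Relation.Nullary using (¬_; yes; no; contradiction)
open import Relation.Nullary.Decidable using (T?; ¬?)
open import Relation.Binary.PropositionalEquality

T-ext : ∀ {a b} → (T a → T b) → (T b → T a) → a ≡ b
T-ext {false} {false} _ _ = refl
T-ext {false} {true}  _ g = ⊥-elim (g _)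
T-ext {true}  {false} f _ = ⊥-elim (f _)
T-ext {true}  {true}  _ _ = refl

T-not⇒¬T : ∀ {b} → T (not b) → ¬ T b
T-not⇒¬T {false} _ ()

¬T⇒T-not : ∀ {b} → ¬ T b → T (not b)
¬T⇒T-not {false} _   = _
¬T⇒T-not {true}  ¬tt = ¬tt _

<ᵇ-false : ∀ {m n} → n ≤ m → (m <ᵇ n) ≡ false
<ᵇ-false z≤n       = refl
<ᵇ-false (s≤s n≤m) = <ᵇ-false n≤m

count : {A : Set} → (A → Bool) → List A → ℕ
count p xs = length (filter (λ x → T? (p x)) xs)

count-filter : {A : Set} (p q : A → Bool) (xs : List A) →
  length (filter (λ x → T? (p x)) (filter (λ x → T? (q x)) xs)) ≡ count (λ x → q x ∧ p x) xs
count-filter p q [] = refl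
count-filter p q (x ∷ xs) with q x
... | false = count-filter p q xs
... | true with p x
...   | true  = cong suc (count-filter p q xs)
...   | false = count-filter p q xs

count-cong : {A : Set} {p q : A → Bool} {xs : List A} →
  All (λ x → p x ≡ q x) xs → count p xs ≡ count q xs
count-cong [] = refl
count-cong {p = p} {q} {x ∷ _} (px≡qx ∷ eqs) with p x | q x | px≡qx
... | true  | true  | _ = cong suc (count-cong eqs)
... | false | false | _ = count-cong eqs

count-map : {A B : Set} (p : B → Bool) (f : A → B) (xs : List A) → count p (map f xs) ≡ count (p ∘ f) xs
count-map p f [] = refl
count-map p f (x ∷ xs) with p (f x)
... | true  = cong suc (count-map p f xs)
... | false = count-map p f xs

count-++ : {A : Set} (p : A → Bool) (xs ys : List A) → count p (xs ++ ys) ≡ count p xs + count p ys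
count-++ p xs ys = trans (cong length (filter-++ (λ x → T? (p x)) xs ys)) (length-++ (filter _ xs))

count-concatMap : {A B : Set} (p : B → Bool) (f : A → List B) (xs : List A) →
  count p (concatMap f xs) ≡ sum (map (count p ∘ f) xs)
count-concatMap p f []       = refl
count-concatMap p f (x ∷ xs) =
  trans (count-++ p (f x) (concatMap f xs)) (cong (count p (f x) +_) (count-concatMap p f xs))

count-false : {A : Set} (xs : List A) → count (λ _ → false) xs ≡ 0
count-false []       = refl
count-false (_ ∷ xs) = count-false xs

count-all : {A : Set} {p : A → Bool} {xs : List A} → All (T ∘ p) xs → count p xs ≡ length xs
count-all {p = p} pxs = cong length (filter-all (λ x → T? (p x)) pxs)

count-words-suc : {A : Set} (m : ℕ) (p : Vec A (suc m) → Bool) (xs : List A) →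
  count p (words (suc m) xs) ≡ sum (map (λ x → count (p ∘ (x Vec.∷_)) (words m xs)) xs)
count-words-suc m p xs =
  trans (count-concatMap p _ xs) (cong sum (map-cong (λ x → count-map p (x Vec.∷_) (words m xs)) xs))

count-words-↭ : {A : Set} (m : ℕ) (p : Vec A m → Bool) {xs ys : List A} →
  xs ↭ ys → count p (words m xs) ≡ count p (words m ys)
count-words-↭ zero    p xs↭ys = refl
count-words-↭ (suc m) p {xs} {ys} xs↭ys = begin
  count p (words (suc m) xs)
    ≡⟨ count-words-suc m p xs ⟩
  sum (map (λ x → count (p ∘ (x Vec.∷_)) (words m xs)) xs)
    ≡⟨ cong sum (map-cong (λ x → count-words-↭ m (p ∘ (x Vec.∷_)) xs↭ys) xs) ⟩
  sum (map (λ x → count (p ∘ (x Vec.∷_)) (words m ys)) xs)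
    ≡⟨ sum-↭ (↭.map⁺ _ xs↭ys) ⟩
  sum (map (λ x → count (p ∘ (x Vec.∷_)) (words m ys)) ys)
    ≡⟨ count-words-suc m p ys ⟨
  count p (words (suc m) ys) ∎
  where open ≡-Reasoning

-- In the base case the two singleton lists have different element types, so the counts only
-- compute once p [] is known.
count-words-map : {A B : Set} (m : ℕ) (p : Vec B m → Bool) (f : A → B) (xs : List A) →
  count p (words m (map f xs)) ≡ count (p ∘ Vec.map f) (words m xs)
count-words-map zero    p f xs with p Vec.[]
... | true  = refl
... | false = refl
count-words-map (suc m) p f xs = begin
  count p (words (suc m) (map f xs))
    ≡⟨ count-words-suc m p (map f xs) ⟩
  sum (map (λ y → count (p ∘ (y Vec.∷_)) (words m (map f xs))) (map f xs))
    ≡⟨ cong sum (map-∘ xs) ⟨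
  sum (map (λ x → count (p ∘ (f x Vec.∷_)) (words m (map f xs))) xs)
    ≡⟨ cong sum (map-cong (λ x → count-words-map m (p ∘ (f x Vec.∷_)) f xs) xs) ⟩
  sum (map (λ x → count (p ∘ (f x Vec.∷_) ∘ Vec.map f) (words m xs)) xs)
    ≡⟨ count-words-suc m (p ∘ Vec.map f) xs ⟨
  count (p ∘ Vec.map f) (words (suc m) xs) ∎
  where open ≡-Reasoning

isEvenᵇ-suc : ∀ k → isEvenᵇ (suc k) ≡ not (isEvenᵇ k)
isEvenᵇ-suc zero          = refl
isEvenᵇ-suc (suc zero)    = refl
isEvenᵇ-suc (suc (suc k)) = isEvenᵇ-suc k

isEvenᵇ-+-even : ∀ q k → isEvenᵇ (q * 2 + k) ≡ isEvenᵇ k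
isEvenᵇ-+-even zero    k = refl
isEvenᵇ-+-even (suc q) k = isEvenᵇ-+-even q k

parity-flip : ∀ {i i′ a b q} → i′ + b ≡ i + a → a + suc b ≡ q * 2 → isEvenᵇ i′ ≡ not (isEvenᵇ i)
parity-flip {i} {i′} {a} {b} {q} balance len = begin
  isEvenᵇ i′               ≡⟨ isEvenᵇ-+-even q i′ ⟨
  isEvenᵇ (q * 2 + i′)     ≡⟨ cong isEvenᵇ shift ⟩
  isEvenᵇ (a * 2 + suc i)  ≡⟨ isEvenᵇ-+-even a (suc i) ⟩
  isEvenᵇ (suc i)          ≡⟨ isEvenᵇ-suc i ⟩
  not (isEvenᵇ i)          ∎
  where
  open ≡-Reasoning
  open +-*-Solver
  shift : q * 2 + i′ ≡ a * 2 + suc i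
  shift = begin
    q * 2 + i′
      ≡⟨ cong (_+ i′) len ⟨
    a + suc b + i′
      ≡⟨ solve 3 (λ a b i′ → a :+ (con 1 :+ b) :+ i′ := (con 1 :+ a) :+ (i′ :+ b)) refl a b i′ ⟩
    suc a + (i′ + b)
      ≡⟨ cong (suc a +_) balance ⟩
    suc a + (i + a)
      ≡⟨ solve 2 (λ a i → (con 1 :+ a) :+ (i :+ a) := a :* con 2 :+ (con 1 :+ i)) refl a i ⟩
    a * 2 + suc i ∎

[m%d+n]%d≡[m+n]%d : ∀ m n d .{{_ : NonZero d}} → (m % d + n) % d ≡ (m + n) % d
[m%d+n]%d≡[m+n]%d m n d = begin
  (m % d + n) % d             ≡⟨ %-distribˡ-+ (m % d) n d ⟩
  (m % d % d + n % d) % d     ≡⟨ cong (λ v → (v + n % d) % d) (m%n%n≡m%n m d) ⟩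
  (m % d + n % d) % d         ≡⟨ %-distribˡ-+ m n d ⟨
  (m + n) % d                 ∎
  where open ≡-Reasoning

[m+n%d]%d≡[m+n]%d : ∀ m n d .{{_ : NonZero d}} → (m + n % d) % d ≡ (m + n) % d
[m+n%d]%d≡[m+n]%d m n d = begin
  (m + n % d) % d   ≡⟨ cong (_% d) (+-comm m (n % d)) ⟩
  (n % d + m) % d   ≡⟨ [m%d+n]%d≡[m+n]%d n m d ⟩
  (n + m) % d       ≡⟨ cong (_% d) (+-comm n m) ⟩
  (m + n) % d       ∎
  where open ≡-Reasoning

iterate-preserves : {A : Set} {I : A → Set} (f : A → A) →
  (∀ {a} → I a → I (f a)) → ∀ k {a} → I a → I (iterate f a k)
iterate-preserves         f step zero    Ia = Ia
iterate-preserves {I = I} f step (suc k) Ia = iterate-preserves {I = I} f step k (step Ia)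

periodic-reflects : {A : Set} {I Q : A → Set} (f : A → A) (k : ℕ) →
  (∀ {a} → I a → I (f a)) → (∀ {a} → I a → Q a → Q (f a)) →
  ∀ {a} → I a → iterate f a (suc k) ≡ a → Q (f a) → Q a
periodic-reflects {I = I} {Q} f k invariant preserves Ia period Qfa =
  subst Q period (proj₂ (iterate-preserves {I = λ b → I b × Q b} f
    (λ (Ib , Qb) → invariant Ib , preserves Ib Qb) k (invariant Ia , Qfa)))

distinctᵇ⇒Unique : ∀ xs → T (distinctᵇ xs) → Unique xs
distinctᵇ⇒Unique []       _ = []
distinctᵇ⇒Unique (x ∷ xs) t with Equivalence.to T-∧ t
... | x∉xs , rest = All.tabulate x≢ ∷ distinctᵇ⇒Unique xs rest
  where
  x≢ : ∀ {y} → y ∈ xs → x ≢ y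
  x≢ y∈xs refl = T-not⇒¬T x∉xs (any⁺ _ (Any.map (λ { refl → ≡⇒≡ᵇ x x refl }) y∈xs))

Unique⇒distinctᵇ : ∀ {xs} → Unique xs → T (distinctᵇ xs)
Unique⇒distinctᵇ []                  = _
Unique⇒distinctᵇ {x ∷ xs} (x∉xs ∷ u) = Equivalence.from T-∧ (¬T⇒T-not x≢ , Unique⇒distinctᵇ u)
  where
  x≢ : ¬ T (any (x ≡ᵇ_) xs)
  x≢ t = All.All¬⇒¬Any (All.map (λ x≢y x≡y → x≢y (≡ᵇ⇒≡ x _ x≡y)) x∉xs) (any⁻ _ xs t)

≤∧≢⇒<-All : ∀ {m xs} → All (_≤ m) xs → All (m ≢_) xs → All (_< m) xs
≤∧≢⇒<-All xs≤m m∉xs = All.zipWith (λ (x≤m , m≢x) → ≤∧≢⇒< x≤m (m≢x ∘ sym)) (xs≤m , m∉xs)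

length≤1+length-filter-≢ : ∀ k {xs} → Unique xs → length xs ≤ suc (length (filter (λ x → ¬? (x ≟ k)) xs))
length≤1+length-filter-≢ k []                     = z≤n
length≤1+length-filter-≢ k {x ∷ xs} (x∉xs ∷ u) with x ≟ k
... | yes refl rewrite filter-reject (λ x → ¬? (x ≟ k)) {x} {xs} (λ k≢k → k≢k refl)
                     | filter-all (λ x → ¬? (x ≟ k)) (All.map (λ k≢y y≡k → k≢y (sym y≡k)) x∉xs) = ≤-refl
... | no x≢k rewrite filter-accept (λ x → ¬? (x ≟ k)) {x} {xs} x≢k = s≤s (length≤1+length-filter-≢ k u)

unique-bounded⇒length≤ : ∀ k {xs} → Unique xs → All (_< k) xs → length xs ≤ k
unique-bounded⇒length≤ zero    []      []       = z≤n
unique-bounded⇒length≤ zero    (_ ∷ _) (() ∷ _)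
unique-bounded⇒length≤ (suc k) {xs} u xs<1+k = ≤-trans (length≤1+length-filter-≢ k u)
  (s≤s (unique-bounded⇒length≤ k (Unique.filter⁺ _ u)
    (All.zipWith (λ (x<1+k , x≢k) → ≤∧≢⇒< (s≤s⁻¹ x<1+k) x≢k) (All.filter⁺ _ xs<1+k , All.all-filter _ xs))))

max∈ : ∀ m {xs} → Unique xs → All (_≤ m) xs → length xs ≡ suc m → m ∈ xs
max∈ m {xs} u xs≤m len with m ∈? xs
... | yes m∈xs = m∈xs
... | no  m∉xs = contradiction (subst (_≤ m) len (unique-bounded⇒length≤ m u xs<m)) (<-irrefl refl)
  where
  xs<m : All (_< m) xs
  xs<m = ≤∧≢⇒<-All xs≤m (All.¬Any⇒All¬ xs m∉xs)

below-max : ∀ {m} ys {zs} → Unique (ys ++ m ∷ zs) → All (_≤ m) (ys ++ m ∷ zs) → All (_< m) ys × All (_< m) zs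
below-max []       (m∉zs ∷ _) (_ ∷ zs≤m) = [] , ≤∧≢⇒<-All zs≤m m∉zs
below-max (y ∷ ys) (y∉ ∷ u)   (y≤m ∷ ≤m) with below-max ys u ≤m
... | ys<m , zs<m = ≤∧≢⇒< y≤m (All.lookup y∉ (∈-++⁺ʳ ys (here refl))) ∷ ys<m , zs<m

Unique-map⁺-on : ∀ {P : ℕ → Set} {f : ℕ → ℕ} → (∀ {x y} → P x → P y → f x ≡ f y → x ≡ y) →
  ∀ {xs} → All P xs → Unique xs → Unique (map f xs)
Unique-map⁺-on inj []         []       = []
Unique-map⁺-on inj (px ∷ pxs) (x∉ ∷ u) =
  All.map⁺ (All.zipWith (λ (py , x≢y) fx≡fy → x≢y (inj px py fx≡fy)) (pxs , x∉)) ∷ Unique-map⁺-on inj pxs u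

rot : ℕ → ℕ → ℕ
rot m x = suc x % suc m

rot-max : ∀ m → rot m m ≡ 0
rot-max m = n%n≡0 (suc m)

rot-< : ∀ {m x} → x < m → rot m x ≡ suc x
rot-< x<m = m≤n⇒m%n≡m x<m

rot-≤ : ∀ m x → rot m x ≤ m
rot-≤ m x = s≤s⁻¹ (m%n<n (suc x) (suc m))

rot-<ᵇ : ∀ {m x a} → x < m → a < m → (rot m x <ᵇ rot m a) ≡ (x <ᵇ a)
rot-<ᵇ x<m a<m rewrite rot-< x<m | rot-< a<m = refl

rot-injective : ∀ {m x y} → x ≤ m → y ≤ m → rot m x ≡ rot m y → x ≡ y
rot-injective {m} x≤m y≤m eq with m≤n⇒m<n∨m≡n x≤m | m≤n⇒m<n∨m≡n y≤m
... | inj₁ x<m  | inj₁ y<m  = suc-injective (trans (sym (rot-< x<m)) (trans eq (rot-< y<m)))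
... | inj₁ x<m  | inj₂ refl = contradiction (trans (sym (rot-< x<m)) (trans eq (rot-max m))) λ ()
... | inj₂ refl | inj₁ y<m  = contradiction (trans (sym (rot-< y<m)) (trans (sym eq) (rot-max m))) λ ()
... | inj₂ refl | inj₂ refl = refl

map-rot-below : ∀ {m xs} → All (_< m) xs → map (rot m) xs ≡ map suc xs
map-rot-below = map-cong-local ∘ All.map rot-<

All-≤-map-rot : ∀ m xs → All (_≤ m) (map (rot m) xs)
All-≤-map-rot m xs = All.map⁺ (All.universal (rot-≤ m) xs)

Distinct≤ : ℕ → List ℕ → Set
Distinct≤ m xs = Unique xs × All (_≤ m) xs

Distinct≤-map-rot : ∀ {m xs} → Distinct≤ m xs → Distinct≤ m (map (rot m) xs)
Distinct≤-map-rot {m} {xs} (u , xs≤m) = Unique-map⁺-on rot-injective xs≤m u , All-≤-map-rot m xs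

iterate-map-rot : ∀ m k {xs} → All (_≤ m) xs → iterate (map (rot m)) xs k ≡ map (λ x → (x + k) % suc m) xs
iterate-map-rot m zero xs≤m =
  sym (map-id-local (All.map (λ {x} x≤m → trans (cong (_% suc m) (+-identityʳ x)) (m≤n⇒m%n≡m x≤m)) xs≤m))
iterate-map-rot m (suc k) {xs} xs≤m = begin
  iterate (map (rot m)) (map (rot m) xs) k
    ≡⟨ iterate-map-rot m k (All-≤-map-rot m xs) ⟩
  map (λ x → (x + k) % suc m) (map (rot m) xs)
    ≡⟨ map-∘ xs ⟨
  map (λ x → (rot m x + k) % suc m) xs
    ≡⟨ map-cong (λ x → trans ([m%d+n]%d≡[m+n]%d (suc x) k (suc m)) (cong (_% suc m) (sym (+-suc x k)))) xs ⟩
  map (λ x → (x + suc k) % suc m) xs ∎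
  where open ≡-Reasoning

iterate-map-rot-period : ∀ m {xs} → All (_≤ m) xs → iterate (map (rot m)) xs (suc m) ≡ xs
iterate-map-rot-period m xs≤m = trans (iterate-map-rot m (suc m) xs≤m)
  (map-id-local (All.map (λ {x} x≤m → trans ([m+n]%n≡m%n x (suc m)) (m≤n⇒m%n≡m x≤m)) xs≤m))

distinctᵇ-map-rot : ∀ {m xs} → All (_≤ m) xs → distinctᵇ (map (rot m) xs) ≡ distinctᵇ xs
distinctᵇ-map-rot {m} {xs} xs≤m = T-ext
  (Unique⇒distinctᵇ ∘ Unique.map⁻ {f = rot m} ∘ distinctᵇ⇒Unique (map (rot m) xs))
  (λ t → Unique⇒distinctᵇ (proj₁ (Distinct≤-map-rot (distinctᵇ⇒Unique xs t , xs≤m))))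

-- Rotation changes the sign

inversions-map-suc : ∀ xs → inversions (map suc xs) ≡ inversions xs
inversions-map-suc []       = refl
inversions-map-suc (x ∷ xs) = cong₂ _+_ (count-map (_<ᵇ suc x) suc xs) (inversions-map-suc xs)

count-below-map-rot : ∀ {m y} → y < m → ∀ ys {zs} → All (_< m) ys → All (_< m) zs →
  count (_<ᵇ suc y) (map (rot m) (ys ++ m ∷ zs)) ≡ suc (count (_<ᵇ y) (ys ++ m ∷ zs))
count-below-map-rot {m} {y} y<m [] {zs} [] zs<m rewrite rot-max m | map-rot-below zs<m | <ᵇ-false {m} {y} (<⇒≤ y<m) =
  cong suc (count-map (_<ᵇ suc y) suc zs)
count-below-map-rot {m} {y} y<m (x ∷ ys) (x<m ∷ ys<m) zs<m rewrite rot-< x<m with x <ᵇ y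
... | true  = cong suc (count-below-map-rot y<m ys ys<m zs<m)
... | false = count-below-map-rot y<m ys ys<m zs<m

-- The letter m becomes 0: it loses its inversions with the length zs later letters and gains
-- inversions with the length ys earlier ones; all other comparisons are unchanged.
inversions-map-rot : ∀ {m} ys zs → All (_< m) ys → All (_< m) zs →
  inversions (map (rot m) (ys ++ m ∷ zs)) + length zs ≡ inversions (ys ++ m ∷ zs) + length ys
inversions-map-rot {m} [] zs [] zs<m rewrite rot-max m | map-rot-below zs<m | count-false (map suc zs)
                                           | inversions-map-suc zs | count-all (All.map <⇒<ᵇ zs<m) =
  trans (+-comm (inversions zs) (length zs)) (sym (+-identityʳ _))
inversions-map-rot {m} (y ∷ ys) zs (y<m ∷ ys<m) zs<m rewrite rot-< y<m | count-below-map-rot y<m ys ys<m zs<m =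
  begin
    suc (c + inversions (map (rot m) rest)) + length zs   ≡⟨ cong suc (+-assoc c _ (length zs)) ⟩
    suc (c + (inversions (map (rot m) rest) + length zs)) ≡⟨ cong (λ v → suc (c + v)) (inversions-map-rot ys zs ys<m zs<m) ⟩
    suc (c + (inversions rest + length ys))               ≡⟨ cong suc (+-assoc c _ (length ys)) ⟨
    suc (c + inversions rest + length ys)                 ≡⟨ +-suc _ (length ys) ⟨
    c + inversions rest + suc (length ys)                 ∎
  where
  open ≡-Reasoning
  rest = ys ++ m ∷ zs
  c = count (_<ᵇ y) rest

evenPermᵇ-map-rot : ∀ {m xs} → 2 ∣ suc m → Distinct≤ m xs → length xs ≡ suc m →
  evenPermᵇ (map (rot m) xs) ≡ not (evenPermᵇ xs)
evenPermᵇ-map-rot {m} (divides q n≡q*2) (u , xs≤m) len with ∈-∃++ (max∈ m u xs≤m len)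
... | ys , zs , refl with below-max ys u xs≤m
...   | ys<m , zs<m = parity-flip {q = q} (inversions-map-rot ys zs ys<m zs<m)
                        (trans (sym (length-++ ys)) (trans len n≡q*2))

-- Order patterns

-- The comparison function of sameOrderᵇ is local to a where block, so it is only evaluated
-- through case analysis on x <ᵇ a and y <ᵇ b.
sameOrderᵇ-head⁻ : ∀ {x y xs ys a b} → T (sameOrderᵇ (x ∷ xs) (y ∷ ys)) → (a , b) ∈ zip xs ys →
  (x <ᵇ a) ≡ (y <ᵇ b)
sameOrderᵇ-head⁻ {x} {y} {xs} {ys} {a} {b} so ab∈
  with x <ᵇ a | y <ᵇ b | All.lookup (all⁺ _ (zip xs ys) (proj₁ (Equivalence.to T-∧ so))) ab∈
... | true  | true  | _ = refl
... | false | false | _ = refl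

sameOrderᵇ-head⁺ : ∀ {x y xs ys} → (∀ {a b} → (a , b) ∈ zip xs ys → (x <ᵇ a) ≡ (y <ᵇ b)) →
  T (sameOrderᵇ xs ys) → T (sameOrderᵇ (x ∷ xs) (y ∷ ys))
sameOrderᵇ-head⁺ {x} {y} {xs} {ys} cmp so with T? (sameOrderᵇ (x ∷ xs) (y ∷ ys))
... | yes so′ = so′
... | no ¬so′
  with find (All.¬All⇒Any¬ (λ _ → T? _) (zip xs ys) (λ holds → ¬so′ (Equivalence.from T-∧ (all⁻ _ holds , so))))
... | (a , b) , ab∈ , ¬h with x <ᵇ a | y <ᵇ b | cmp ab∈
... | true  | true  | _ = ⊥-elim (¬h _)
... | false | false | _ = ⊥-elim (¬h _)

data SameOrder : List ℕ → List ℕ → Set where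
  []  : SameOrder [] []
  _∷_ : ∀ {x y xs ys} → Pointwise (λ a b → (x <ᵇ a) ≡ (y <ᵇ b)) xs ys → SameOrder xs ys →
        SameOrder (x ∷ xs) (y ∷ ys)

SameOrder-length : ∀ {xs ys} → SameOrder xs ys → length xs ≡ length ys
SameOrder-length []       = refl
SameOrder-length (_ ∷ so) = cong suc (SameOrder-length so)

Pointwise⇒zip-∈ : ∀ {R : ℕ → ℕ → Set} {xs ys a b} → Pointwise R xs ys → (a , b) ∈ zip xs ys → R a b
Pointwise⇒zip-∈ (r ∷ _)  (here refl) = r
Pointwise⇒zip-∈ (_ ∷ rs) (there ab∈) = Pointwise⇒zip-∈ rs ab∈

zip-∈⇒Pointwise : ∀ {R : ℕ → ℕ → Set} xs ys → length xs ≡ length ys →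
  (∀ {a b} → (a , b) ∈ zip xs ys → R a b) → Pointwise R xs ys
zip-∈⇒Pointwise []       []       _   _ = []
zip-∈⇒Pointwise (x ∷ xs) (y ∷ ys) len r = r (here refl) ∷ zip-∈⇒Pointwise xs ys (suc-injective len) (r ∘ there)

sameOrderᵇ⇒SameOrder : ∀ xs ys → T (sameOrderᵇ xs ys) → SameOrder xs ys
sameOrderᵇ⇒SameOrder []       []       _  = []
sameOrderᵇ⇒SameOrder (x ∷ xs) (y ∷ ys) so =
  zip-∈⇒Pointwise xs ys (SameOrder-length tail) (sameOrderᵇ-head⁻ so) ∷ tail
  where tail = sameOrderᵇ⇒SameOrder xs ys (proj₂ (Equivalence.to T-∧ so))

SameOrder⇒sameOrderᵇ : ∀ {xs ys} → SameOrder xs ys → T (sameOrderᵇ xs ys)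
SameOrder⇒sameOrderᵇ []         = _
SameOrder⇒sameOrderᵇ (cmp ∷ so) = sameOrderᵇ-head⁺ (Pointwise⇒zip-∈ cmp) (SameOrder⇒sameOrderᵇ so)

SameOrder-map : ∀ {R : ℕ → ℕ → Set} (h k : ℕ → ℕ) →
  (∀ {x y a b} → R x y → R a b → (x <ᵇ a) ≡ (y <ᵇ b) → (h x <ᵇ h a) ≡ (k y <ᵇ k b)) →
  ∀ {xs ys} → Pointwise R xs ys → SameOrder xs ys → SameOrder (map h xs) (map k ys)
SameOrder-map     h k compat []         []         = []
SameOrder-map {R} h k compat (rxy ∷ rs) (cmp ∷ so) = head rxy rs cmp ∷ SameOrder-map h k compat rs so
  where
  head : ∀ {x y as bs} → R x y → Pointwise R as bs → Pointwise (λ a b → (x <ᵇ a) ≡ (y <ᵇ b)) as bs →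
    Pointwise (λ a b → (h x <ᵇ a) ≡ (k y <ᵇ b)) (map h as) (map k bs)
  head rxy []         []       = []
  head rxy (rab ∷ rs) (c ∷ cs) = compat rxy rab c ∷ head rxy rs cs

All×All⇒Pointwise : ∀ {P Q : ℕ → Set} xs ys → length xs ≡ length ys → All P xs → All Q ys →
  Pointwise (λ a b → P a × Q b) xs ys
All×All⇒Pointwise []       []       _   _          _          = []
All×All⇒Pointwise (x ∷ xs) (y ∷ ys) len (px ∷ pxs) (qy ∷ qys) =
  (px , qy) ∷ All×All⇒Pointwise xs ys (suc-injective len) pxs qys

head-max : ∀ {x y xs ys} → Pointwise (λ a b → (x <ᵇ a) ≡ (y <ᵇ b)) xs ys → All (_≤ x) xs → All (_≤ y) ys
head-max []       []           = []
head-max (c ∷ cs) (a≤x ∷ as≤x) = ≮⇒≥ (λ y<b → subst T (trans (sym c) (<ᵇ-false a≤x)) (<⇒<ᵇ y<b)) ∷ head-max cs as≤x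

Aligned : ℕ → ℕ → ℕ → ℕ → Set
Aligned m M x y = (x ≡ m × y ≡ M) ⊎ (x < m × y < M)

maxima-aligned : ∀ {m M xs ys} → SameOrder xs ys → Distinct≤ m xs → Distinct≤ M ys →
  m ∈ xs → M ∈ ys → Pointwise (Aligned m M) xs ys
maxima-aligned (cmp ∷ so) (x∉xs ∷ ux , x≤m ∷ xs≤m) (y∉ys ∷ uy , y≤M ∷ ys≤M) m∈ M∈
  with m≤n⇒m<n∨m≡n x≤m | m≤n⇒m<n∨m≡n y≤M
... | inj₂ refl | inj₂ refl = inj₁ (refl , refl) ∷
  Pointwise.map inj₂ (All×All⇒Pointwise _ _ (SameOrder-length so) (≤∧≢⇒<-All xs≤m x∉xs) (≤∧≢⇒<-All ys≤M y∉ys))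
... | inj₂ refl | inj₁ y<M =
  contradiction (All.lookup (head-max cmp xs≤m) (Any.tail (<⇒≢ y<M ∘ sym) M∈)) (<⇒≱ y<M)
... | inj₁ x<m  | inj₂ refl =
  contradiction (All.lookup (head-max (Pointwise.symmetric sym cmp) ys≤M) (Any.tail (<⇒≢ x<m ∘ sym) m∈)) (<⇒≱ x<m)
... | inj₁ x<m  | inj₁ y<M = inj₂ (x<m , y<M) ∷
  maxima-aligned so (ux , xs≤m) (uy , ys≤M) (Any.tail (<⇒≢ x<m ∘ sym) m∈) (Any.tail (<⇒≢ y<M ∘ sym) M∈)

rot-aligned-compat : ∀ {m M x y a b} → Aligned m M x y → Aligned m M a b → (x <ᵇ a) ≡ (y <ᵇ b) →
  (rot m x <ᵇ rot m a) ≡ (rot M y <ᵇ rot M b)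
rot-aligned-compat {m} {M} (inj₁ (refl , refl)) (inj₁ (refl , refl)) _ rewrite rot-max m | rot-max M = refl
rot-aligned-compat {m} {M} (inj₁ (refl , refl)) (inj₂ (a<m , b<M)) _
  rewrite rot-max m | rot-max M | rot-< a<m | rot-< b<M = refl
rot-aligned-compat {m} {M} (inj₂ _) (inj₁ (refl , refl)) _ rewrite rot-max m | rot-max M = refl
rot-aligned-compat (inj₂ (x<m , y<M)) (inj₂ (a<m , b<M)) cmp =
  trans (rot-<ᵇ x<m a<m) (trans cmp (sym (rot-<ᵇ y<M b<M)))

-- Rotation preserves non-avoiders

upTo≤ : ∀ M → All (_≤ M) (upTo (suc M))
upTo≤ M = All.tabulate (s≤s⁻¹ ∘ ∈-upTo⁻)

Distinct≤-cyclicShift : ∀ M s → Distinct≤ M (cyclicShift (suc M) s)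
Distinct≤-cyclicShift M s = subst (Distinct≤ M) (iterate-map-rot M s (upTo≤ M))
  (iterate-preserves {I = Distinct≤ M} (map (rot M)) Distinct≤-map-rot s (Unique.upTo⁺ (suc M) , upTo≤ M))

max∈cyclicShift : ∀ M s → M ∈ cyclicShift (suc M) s
max∈cyclicShift M s = max∈ M (proj₁ (Distinct≤-cyclicShift M s)) (proj₂ (Distinct≤-cyclicShift M s))
  (trans (length-map _ (upTo (suc M))) (length-upTo (suc M)))

cyclicShift-suc : ∀ M s → map (rot M) (cyclicShift (suc M) s) ≡ cyclicShift (suc M) (suc s)
cyclicShift-suc M s = trans (sym (map-∘ (upTo (suc M))))
  (map-cong (λ i → trans ([m+n%d]%d≡[m+n]%d 1 (i + s) (suc M)) (cong (_% suc M) (sym (+-suc i s)))) (upTo (suc M)))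

cyclicShift-mod : ∀ M s → cyclicShift (suc M) (s % suc M) ≡ cyclicShift (suc M) s
cyclicShift-mod M s = map-cong (λ i → [m+n%d]%d≡[m+n]%d i s (suc M)) (upTo (suc M))

SameOrder-rot-fixed : ∀ {m M s f} → All (_< m) f → SameOrder f (cyclicShift (suc M) s) →
  SameOrder (map (rot m) f) (cyclicShift (suc M) s)
SameOrder-rot-fixed {m} {M} {s} {f} f<m so = subst (SameOrder _) (map-id g)
  (SameOrder-map (rot m) id (λ (x<m , _) (a<m , _) → trans (rot-<ᵇ x<m a<m))
    (All×All⇒Pointwise f g (SameOrder-length so) f<m (proj₂ (Distinct≤-cyclicShift M s))) so)
  where g = cyclicShift (suc M) s

SameOrder-rot-shift : ∀ {m M s f} → Distinct≤ m f → m ∈ f → SameOrder f (cyclicShift (suc M) s) →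
  SameOrder (map (rot m) f) (cyclicShift (suc M) (suc s))
SameOrder-rot-shift {m} {M} {s} df m∈f so = subst (SameOrder _) (cyclicShift-suc M s)
  (SameOrder-map (rot m) (rot M) rot-aligned-compat
    (maxima-aligned so df (Distinct≤-cyclicShift M s) m∈f (max∈cyclicShift M s)) so)

isHit-map-rot : ∀ {m} c {f} → Distinct≤ m f → T (isHitᵇ c f) → T (isHitᵇ c (map (rot m) f))
isHit-map-rot {m} (suc M) {f} (uf , f≤m) hit with m ∈? f
... | no m∉f = any⁺ _ (Any.map (SameOrder⇒sameOrderᵇ ∘ SameOrder-rot-fixed f<m ∘ sameOrderᵇ⇒SameOrder _ _)
                               (any⁻ _ (upTo (suc M)) hit))
  where f<m = ≤∧≢⇒<-All f≤m (All.¬Any⇒All¬ f m∉f)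
... | yes m∈f with find (any⁻ _ (upTo (suc M)) hit)
...   | s , _ , so = any⁺ _ (lose (∈-upTo⁺ (m%n<n (suc s) (suc M)))
          (SameOrder⇒sameOrderᵇ (subst (SameOrder _) (sym (cyclicShift-mod M (suc s)))
            (SameOrder-rot-shift (uf , f≤m) m∈f (sameOrderᵇ⇒SameOrder _ _ so)))))

∈-factors : ∀ c xs {f} → f ∈ factors c xs → ∃[ i ] f ≡ take c (drop i xs)
∈-factors c (x ∷ xs) f∈ with c ≤ᵇ suc (length xs)
∈-factors c (x ∷ xs) (here refl) | true = 0 , refl
∈-factors c (x ∷ xs) (there f∈) | true with ∈-factors c xs f∈
... | i , refl = suc i , refl
∈-factors c (x ∷ xs) f∈ | false with ∈-factors c xs f∈
... | i , refl = suc i , refl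

Distinct≤-factor : ∀ {m c w f} → Distinct≤ m w → f ∈ factors c w → Distinct≤ m f
Distinct≤-factor {c = c} {w} (u , w≤m) f∈ with ∈-factors c w f∈
... | i , refl = Unique.take⁺ c (Unique.drop⁺ i u) , All.take⁺ c (All.drop⁺ i w≤m)

factors-map : ∀ c (h : ℕ → ℕ) xs → factors c (map h xs) ≡ map (map h) (factors c xs)
factors-map c h []       = refl
factors-map c h (x ∷ xs) rewrite length-map h xs | factors-map c h xs with c ≤ᵇ suc (length xs)
... | true  = cong (_∷ map (map h) (factors c xs)) (take-map c (x ∷ xs))
... | false = refl

nonAvoider-map-rot : ∀ {m} c {w} → Distinct≤ m w → T (nonAvoiderᵇ c w) → T (nonAvoiderᵇ c (map (rot m) w))
nonAvoider-map-rot {m} c {w} d na with find (any⁻ _ (factors c w) na)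
... | f , f∈ , hit = any⁺ _ (lose (subst (map (rot m) f ∈_) (sym (factors-map c (rot m) w)) (∈-map⁺ (map (rot m)) f∈))
                                 (isHit-map-rot c (Distinct≤-factor d f∈) hit))

nonAvoiderᵇ-map-rot : ∀ {m} c {w} → Distinct≤ m w → nonAvoiderᵇ c (map (rot m) w) ≡ nonAvoiderᵇ c w
nonAvoiderᵇ-map-rot {m} c {w} d = T-ext
  (periodic-reflects {Q = T ∘ nonAvoiderᵇ c} (map (rot m)) m Distinct≤-map-rot (λ {v} → nonAvoider-map-rot c {v}) d
    (iterate-map-rot-period m (proj₂ d)))
  (nonAvoider-map-rot c d)

evenNonAvoiderᵇ oddNonAvoiderᵇ : ℕ → List ℕ → Bool
evenNonAvoiderᵇ c w = distinctᵇ w ∧ (nonAvoiderᵇ c w ∧ evenPermᵇ w)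
oddNonAvoiderᵇ  c w = distinctᵇ w ∧ (nonAvoiderᵇ c w ∧ not (evenPermᵇ w))

oddNonAvoiderᵇ-map-rot : ∀ {m} c {w} → 2 ∣ suc m → All (_≤ m) w → length w ≡ suc m →
  oddNonAvoiderᵇ c (map (rot m) w) ≡ evenNonAvoiderᵇ c w
oddNonAvoiderᵇ-map-rot {m} c {w} 2∣n w≤m len rewrite distinctᵇ-map-rot w≤m with distinctᵇ w in distinct
... | false = refl
... | true with distinctᵇ⇒Unique w (subst T (sym distinct) _)
...   | u rewrite nonAvoiderᵇ-map-rot c (u , w≤m) | evenPermᵇ-map-rot 2∣n (u , w≤m) len
              | not-involutive (evenPermᵇ w) = refl

rotFin : ∀ m → Fin (suc m) → Fin (suc m)
rotFin m i = fromℕ< (m%n<n (suc (toℕ i)) (suc m))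

toℕ-rotFin : ∀ m i → toℕ (rotFin m i) ≡ rot m (toℕ i)
toℕ-rotFin m i = toℕ-fromℕ< _

oneLine-map-rotFin : ∀ {m} (σ : Vec (Fin (suc m)) (suc m)) →
  oneLine (Vec.map (rotFin m) σ) ≡ map (rot m) (oneLine σ)
oneLine-map-rotFin {m} σ = begin
  Vec.toList (Vec.map toℕ (Vec.map (rotFin m) σ))   ≡⟨ cong Vec.toList (Vec.map-∘ toℕ (rotFin m) σ) ⟨
  Vec.toList (Vec.map (toℕ ∘ rotFin m) σ)           ≡⟨ cong Vec.toList (Vec.map-cong (toℕ-rotFin m) σ) ⟩
  Vec.toList (Vec.map (rot m ∘ toℕ) σ)              ≡⟨ cong Vec.toList (Vec.map-∘ (rot m) toℕ σ) ⟩
  Vec.toList (Vec.map (rot m) (Vec.map toℕ σ))      ≡⟨ Vec.toList-map (rot m) (Vec.map toℕ σ) ⟩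
  map (rot m) (oneLine σ)                           ∎
  where open ≡-Reasoning

oneLine-≤ : ∀ {m} (σ : Vec (Fin (suc m)) (suc m)) → All (_≤ m) (oneLine σ)
oneLine-≤ σ =
  subst (All _) (sym (Vec.toList-map toℕ σ)) (All.map⁺ (All.universal (s≤s⁻¹ ∘ toℕ<n) (Vec.toList σ)))

length-oneLine : ∀ {n} (σ : Vec (Fin n) n) → length (oneLine σ) ≡ n
length-oneLine σ = Vec.length-toList (Vec.map toℕ σ)

tabulate-∷ʳ : {A : Set} {m : ℕ} (F : Fin (suc m) → A) → tabulate F ≡ tabulate (F ∘ inject₁) ∷ʳ F (fromℕ m)
tabulate-∷ʳ {m = zero}  F = refl
tabulate-∷ʳ {m = suc m} F = cong (F fzero ∷_) (tabulate-∷ʳ (F ∘ fsuc))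

map-rotFin-allFin : ∀ m → map (rotFin m) (allFin (suc m)) ≡ tabulate fsuc ∷ʳ fzero
map-rotFin-allFin m = begin
  map (rotFin m) (allFin (suc m))                       ≡⟨ map-tabulate id (rotFin m) ⟩
  tabulate (rotFin m)                                   ≡⟨ tabulate-∷ʳ (rotFin m) ⟩
  tabulate (rotFin m ∘ inject₁) ∷ʳ rotFin m (fromℕ m)   ≡⟨ cong₂ _∷ʳ_ (tabulate-cong rotFin-inject₁) rotFin-fromℕ ⟩
  tabulate fsuc ∷ʳ fzero                                ∎
  where
  open ≡-Reasoning
  rotFin-inject₁ : ∀ i → rotFin m (inject₁ i) ≡ fsuc i
  rotFin-inject₁ i = toℕ-injective
    (trans (toℕ-rotFin m (inject₁ i)) (trans (cong (rot m) (toℕ-inject₁ i)) (rot-< (toℕ<n i))))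
  rotFin-fromℕ : rotFin m (fromℕ m) ≡ fzero
  rotFin-fromℕ = toℕ-injective
    (trans (toℕ-rotFin m (fromℕ m)) (trans (cong (rot m) (toℕ-fromℕ m)) (rot-max m)))

map-rotFin-allFin-↭ : ∀ m → map (rotFin m) (allFin (suc m)) ↭ allFin (suc m)
map-rotFin-allFin-↭ m =
  subst (_↭ allFin (suc m)) (sym (map-rotFin-allFin m)) (↭-sym (↭.∷↭∷ʳ fzero (tabulate fsuc)))

evenNonAvoiders≡oddNonAvoiders : ∀ c n → 2 ∣ n → evenNonAvoiders c n ≡ oddNonAvoiders c n
evenNonAvoiders≡oddNonAvoiders c zero    _   = refl
evenNonAvoiders≡oddNonAvoiders c (suc m) 2∣n = begin
  evenNonAvoiders c n
    ≡⟨ count-filter _ (distinctᵇ ∘ oneLine) (words n A) ⟩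
  count (evenNonAvoiderᵇ c ∘ oneLine) (words n A)
    ≡⟨ count-cong (All.universal rotate (words n A)) ⟩
  count (oddNonAvoiderᵇ c ∘ oneLine ∘ Vec.map (rotFin m)) (words n A)
    ≡⟨ count-words-map n _ (rotFin m) A ⟨
  count (oddNonAvoiderᵇ c ∘ oneLine) (words n (map (rotFin m) A))
    ≡⟨ count-words-↭ n _ (map-rotFin-allFin-↭ m) ⟩
  count (oddNonAvoiderᵇ c ∘ oneLine) (words n A)
    ≡⟨ count-filter _ (distinctᵇ ∘ oneLine) (words n A) ⟨
  oddNonAvoiders c n ∎
  where
  open ≡-Reasoning
  n = suc m
  A = allFin n
  rotate : (σ : Vec (Fin n) n) → evenNonAvoiderᵇ c (oneLine σ) ≡ oddNonAvoiderᵇ c (oneLine (Vec.map (rotFin m) σ))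
  rotate σ = sym (trans (cong (oddNonAvoiderᵇ c) (oneLine-map-rotFin σ))
                        (oddNonAvoiderᵇ-map-rot c 2∣n (oneLine-≤ σ) (length-oneLine σ)))

mainTheorem5 : (c n : ℕ) → 1 < c → ¬ (2 ∣ c) → c < n → 2 ∣ n →
    evenNonAvoiders c n ≡ oddNonAvoiders c n
mainTheorem5 c n _ _ _ 2∣n = evenNonAvoiders≡oddNonAvoiders c n 2∣n
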